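{- Let $\Gamma$ be an AGW graph and fix a coloring of $\Gamma$, turning it into a deterministic complete automaton. Let $w$ be the weight of an $F$-maximal set of this automaton. Then every $F$-clique of this automaton has the same size, namely $w(\Gamma)/w$ (which is the number of sets in a partition of the vertex set of $\Gamma$ into $F$-maximal sets).
   Context: An AGW graph is a finite directed strongly connected graph (multiple edges between the same pair of vertices allowed) in which all vertices have the same outdegree $k$, and the greatest common divisor of the lengths of all its cycles is $1$. A coloring of $\Gamma$ assigns to the edges letters from an alphabet $\Sigma$ with $|\Sigma|=k$ so that the $k$ outgoing edges of each vertex receive distinct letters; this yields a deterministic complete automaton whose states are the vertices. For a state $\mathbf p$ and a word $s=\sigma_1\cdots\sigma_m\in\Sigma^+$, $\mathbf p s$ denotes the end of the path from $\mathbf p$ labeled $s$; for a set $P$ of states, $Ps=\{\mathbf p s:\mathbf p\in P\}$, $Ps^{ -1}$ is the largest set $Q$ of states with $Qs\subseteq P$, and $\Gamma s$ is the image of the whole state set. Weights: let $u$ be a left eigenvector with positive integer components having no common divisor of the adjacency matrix of $\Gamma$ (vertices $\mathbf p_1,\dots,\mathbf p_n$); $w(\mathbf p_i)=u_i$, and for a set $D$ of vertices $w(D)=\sum_{\mathbf p\in D}w(\mathbf p)$; $w(\Gamma)$ is the weight of the whole vertex set. A pair of distinct states $\mathbf p,\mathbf q$ is synchronizing if $\mathbf p s=\mathbf q s$ for some $s\in\Sigma^+$, and a deadlock otherwise. A set $D$ of states is $F$-maximal if $|Ds|=1$ for some $s\in\Sigma^+$ and $w(D)$ is maximal among all sets with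 this property. An $F$-clique is a set of the form $\Gamma s$ for some $s\in\Sigma^+$ such that every pair of distinct states in it is a deadlock. (It is known that the vertex set of $\Gamma$ admits a partition into $F$-maximal sets, all of the same weight.) -}

module Defs where

open import Data.Nat using (ℕ; zero; suc; _+_; _*_; _≤_; _<_)
open import Data.Nat.Divisibility using (_∣_)
open import Data.Fin using (Fin; _≟_)
open import Data.Fin.Subset using (Subset; _∈_; ⊤; ∣_∣)
open import Data.Bool using (Bool; true; false; _∧_; if_then_else_)
open import Data.List using (List; []; _∷_; length; filter; map; allFin; foldl)
open import Data.Nat.ListAction using (sum)
open import Data.Bool.ListAction using (any)
open import Data.List.NonEmpty using (List⁺; toList)
open import Data.Vec using (tabulate; lookup)
open import Data.Product using (Σ; ∃; _×_; _,_)
open import Relation.Nullary using (¬_; ⌊_⌋)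
open import Relation.Binary.PropositionalEquality using (_≡_; _≢_)

-- A deterministic complete automaton with states Fin n over the alphabet Fin k.
-- Its underlying multigraph (one edge p → δ p a for each letter a) is the graph Γ,
-- and δ is a coloring of it.
Automaton : ℕ → ℕ → Set
Automaton n k = Fin n → Fin k → Fin n

module _ {n k : ℕ} (δ : Automaton n k) where

  run : Fin n → List (Fin k) → Fin n
  run p s = foldl δ p s

  run⁺ : Fin n → List⁺ (Fin k) → Fin n
  run⁺ p s = run p (toList s)

  img : Subset n → List⁺ (Fin k) → Subset n
  img D s = tabulate λ q → any (λ p → lookup D p ∧ ⌊ run⁺ p s ≟ q ⌋) (allFin n)

  imgΓ : List⁺ (Fin k) → Subset n
  imgΓ s = img ⊤ s

  adj : Fin n → Fin n → ℕ
  adj i j = length (filter (λ a → δ i a ≟ j) (allFin k))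

  StronglyConnected : Set
  StronglyConnected = ∀ p q → ∃ λ (s : List (Fin k)) → run p s ≡ q

  CycleGcdOne : Set
  CycleGcdOne = ∀ d → (∀ p (s : List⁺ (Fin k)) → run⁺ p s ≡ p → d ∣ length (toList s)) → d ≡ 1

  -- AGW: strongly connected, constant outdegree k (built into Automaton), gcd of cycle lengths 1
  AGW : Set
  AGW = StronglyConnected × CycleGcdOne

  IsWeightVector : (Fin n → ℕ) → Set
  IsWeightVector u =
    (∃ λ (ev : ℕ) → ∀ j → sum (map (λ i → u i * adj i j) (allFin n)) ≡ ev * u j)
    × (∀ i → 0 < u i)
    × (∀ d → (∀ i → d ∣ u i) → d ≡ 1)

  weight : (Fin n → ℕ) → Subset n → ℕ
  weight u D = sum (map (λ p → if lookup D p then u p else 0) (allFin n))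

  Collapsible : Subset n → Set
  Collapsible D = ∃ λ (s : List⁺ (Fin k)) → ∣ img D s ∣ ≡ 1

  FMaximal : (Fin n → ℕ) → Subset n → Set
  FMaximal u D = Collapsible D × (∀ D' → Collapsible D' → weight u D' ≤ weight u D)

  Synchronizing : Fin n → Fin n → Set
  Synchronizing p q = p ≢ q × ∃ λ (s : List⁺ (Fin k)) → run⁺ p s ≡ run⁺ q s

  Deadlock : Fin n → Fin n → Set
  Deadlock p q = p ≢ q × ¬ (∃ λ (s : List⁺ (Fin k)) → run⁺ p s ≡ run⁺ q s)

  FClique : Subset n → Set
  FClique C = (∃ λ (s : List⁺ (Fin k)) → C ≡ imgΓ s)
            × (∀ p q → p ∈ C → q ∈ C → p ≢ q → Deadlock p q)

module Submission where

-- Let D be F-maximal, collapsed by a word t onto a single state p, and let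
-- F = p t⁻¹ be the set of states sent to p by t.  The argument has three steps.
--
--  (1) Stationarity.  As u is a left eigenvector of the adjacency matrix with
--      eigenvalue ev, the weights of the k preimages P a⁻¹ (a a letter) of any
--      set P add up to ev · w(P); taking P = Γ and u > 0 shows ev = k.
--  (2) Rigidity.  Every preimage F x⁻¹ is collapsed by the word x t, so it
--      weighs at most w(D), while F ⊇ D weighs exactly w(D).  By induction on
--      x: the k sets F (a x)⁻¹ weigh at most w(D) each and k · w(D) together,
--      so each weighs exactly w(D).
--  (3) Counting.  Let C = Γs be an F-clique and c ∈ C; pick y leading c into D.
--      Distinct states of C are deadlocks, so the fibre c s⁻¹ equals F (s y)⁻¹
--      and weighs w(D).  These fibres partition Γ, so w(Γ) = |C| · w(D).

open import Defs
open import Data.Nat using (ℕ; zero; suc; _+_; _*_; _≤_; _<_; z≤n; >-nonZero)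
open import Data.Nat.Properties
  using (+-*-semiring; *-commutativeSemigroup; ≤-refl; ≤-trans; ≤-antisym; ≤-reflexive;
         +-mono-≤; +-monoʳ-≤; *-monoˡ-≤; m≤m+n; m≤n+m; +-cancelʳ-≤; +-cancelˡ-≡; *-cancelʳ-≡; *-identityˡ; *-comm;
         *-zeroʳ; +-identityʳ; suc-injective; module ≤-Reasoning)
import Data.Nat.ListAction as List
open import Data.Fin using (Fin; zero; suc; _≟_)
open import Data.Fin.Properties using (any?)
open import Data.Fin.Subset using (Subset; ⊤; ⊥; ∣_∣; _∈_; _⊆_; ⁅_⁆)
open import Data.Fin.Subset.Properties using (⊆-antisym; ∈⊤; x∈⁅x⁆; x∈⁅y⁆⇒x≡y; ∣⁅x⁆∣≡1)
open import Data.Bool using (Bool; true; false; T; if_then_else_)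
open import Data.Bool.Properties using (T-∧)
open import Data.List using (List; []; _∷_; map; allFin; filter; length; _++_)
import Data.List as L
open import Data.List.Properties using (map-tabulate; foldl-++)
open import Data.List.NonEmpty using (List⁺; _∷_; _∷⁺_; toList; _++⁺_)
open import Data.List.Membership.Propositional using (lose)
open import Data.List.Membership.Propositional.Properties using (∈-allFin)
open import Data.List.Relation.Unary.Any using (satisfied)
open import Data.List.Relation.Unary.Any.Properties using (any⁺; any⁻)
open import Data.Vec using ([]; _∷_; lookup; tabulate; here; there)
open import Data.Vec.Properties using (lookup∘tabulate; lookup-replicate)
open import Data.Product using (∃; _×_; _,_; proj₂)
open import Data.Unit using (tt)
open import Data.Empty using (⊥-elim)
open import Function using (_∘_; id; Equivalence)
open import Relation.Nullary using (¬_; yes; no; does)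
open import Relation.Nullary.Decidable using (toWitness; fromWitness; T?; dec-true; dec-false)
open import Level using (0ℓ)
open import Relation.Unary using (Pred; Decidable)
open import Relation.Binary.PropositionalEquality
open import Algebra.Properties.CommutativeSemigroup *-commutativeSemigroup using (x∙yz≈y∙xz; xy∙z≈x∙zy)
open import Algebra.Properties.Semiring.Sum +-*-semiring
  using (sum; sum-syntax; sum-cong-≗; ∑-comm; *-distribˡ-sum; *-distribʳ-sum)

χ : Bool → ℕ
χ true  = 1
χ false = 0

χ-mono : ∀ {a b} → (T a → T b) → χ a ≤ χ b
χ-mono {false}         _ = z≤n
χ-mono {true}  {true}  _ = ≤-refl
χ-mono {true}  {false} h = ⊥-elim (h tt)

sum-allFin : ∀ {n} (f : Fin n → ℕ) → List.sum (map f (allFin n)) ≡ ∑[ i < n ] f i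
sum-allFin {n} f = trans (cong List.sum (map-tabulate id f)) (sum-tabulate n f)
  where
  sum-tabulate : ∀ m (g : Fin m → ℕ) → List.sum (L.tabulate g) ≡ ∑[ i < m ] g i
  sum-tabulate zero    g = refl
  sum-tabulate (suc m) g = cong (g zero +_) (sum-tabulate m (g ∘ suc))

∑-const : ∀ n c → ∑[ i < n ] c ≡ n * c
∑-const zero    c = refl
∑-const (suc n) c = cong (c +_) (∑-const n c)

∑-mono : ∀ {n} {f g : Fin n → ℕ} → (∀ i → f i ≤ g i) → sum f ≤ sum g
∑-mono {zero}  _ = z≤n
∑-mono {suc n} h = +-mono-≤ (h zero) (∑-mono (h ∘ suc))

∑-term : ∀ {n} (f : Fin n → ℕ) i → f i ≤ sum f
∑-term f zero    = m≤m+n _ _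
∑-term f (suc i) = ≤-trans (∑-term (f ∘ suc) i) (m≤n+m _ _)

∑-select : ∀ {n} (e : Fin n) (g : Fin n → ℕ) → ∑[ j < n ] (χ (does (e ≟ j)) * g j) ≡ g e
∑-select {suc n} zero    g =
  trans (cong₂ _+_ (*-identityˡ (g zero)) (trans (∑-const n 0) (*-zeroʳ n))) (+-identityʳ (g zero))
∑-select {suc n} (suc e) g = ∑-select e (g ∘ suc)

∑-all-equal : ∀ {n} (f : Fin n → ℕ) w → (∀ i → f i ≤ w) → sum f ≡ n * w → ∀ i → f i ≡ w
∑-all-equal {suc n} f w f≤w ∑f≡ = all-equal
  where
  rest≤ : ∑[ i < n ] f (suc i) ≤ n * w
  rest≤ = ≤-trans (∑-mono (f≤w ∘ suc)) (≤-reflexive (∑-const n w))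
  head≡ : f zero ≡ w
  head≡ = ≤-antisym (f≤w zero) (+-cancelʳ-≤ (n * w) w (f zero) (begin
    w + n * w                       ≡⟨ ∑f≡ ⟨
    f zero + ∑[ i < n ] f (suc i)   ≤⟨ +-monoʳ-≤ (f zero) rest≤ ⟩
    f zero + n * w                  ∎))
    where open ≤-Reasoning
  rest≡ : ∑[ i < n ] f (suc i) ≡ n * w
  rest≡ = +-cancelˡ-≡ w _ _ (trans (cong (_+ _) (sym head≡)) ∑f≡)
  all-equal : ∀ i → f i ≡ w
  all-equal zero    = head≡
  all-equal (suc i) = ∑-all-equal (f ∘ suc) w (f≤w ∘ suc) rest≡ i

length-filter-tabulate : ∀ {A : Set} {P : Pred A 0ℓ} (P? : Decidable P) {m} (g : Fin m → A) →
                         length (filter P? (L.tabulate g)) ≡ ∑[ a < m ] χ (does (P? (g a)))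
length-filter-tabulate P? {zero}  g = refl
length-filter-tabulate P? {suc m} g with does (P? (g zero))
... | true  = cong suc (length-filter-tabulate P? (g ∘ suc))
... | false = length-filter-tabulate P? (g ∘ suc)

T⇒≡ : ∀ {n} {a b : Fin n} → T (does (a ≟ b)) → a ≡ b
T⇒≡ {a = a} {b} _ with a ≟ b
... | yes a≡b = a≡b

≡⇒T : ∀ {n} {a b : Fin n} → a ≡ b → T (does (a ≟ b))
≡⇒T {a = a} {b} a≡b = subst T (sym (dec-true (a ≟ b) a≡b)) tt

∈⇒T : ∀ {n} {X : Subset n} {x} → x ∈ X → T (lookup X x)
∈⇒T here        = tt
∈⇒T (there x∈X) = ∈⇒T x∈X

T⇒∈ : ∀ {n} (X : Subset n) x → T (lookup X x) → x ∈ X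
T⇒∈ (true ∷ X) zero    _ = here
T⇒∈ (_    ∷ X) (suc x) t = there (T⇒∈ X x t)

∈-tabulate⁻ : ∀ {n} {P : Fin n → Bool} {x} → x ∈ tabulate P → T (P x)
∈-tabulate⁻ {P = P} {x} x∈ = subst T (lookup∘tabulate P x) (∈⇒T x∈)

∈-tabulate⁺ : ∀ {n} {P : Fin n → Bool} {x} → T (P x) → x ∈ tabulate P
∈-tabulate⁺ {P = P} {x} Px = T⇒∈ (tabulate P) x (subst T (sym (lookup∘tabulate P x)) Px)

∣∣-as-sum : ∀ {n} (X : Subset n) → ∣ X ∣ ≡ ∑[ x < n ] χ (lookup X x)
∣∣-as-sum []          = refl
∣∣-as-sum (true  ∷ X) = cong suc (∣∣-as-sum X)
∣∣-as-sum (false ∷ X) = ∣∣-as-sum X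

card≡0⇒⊥ : ∀ {n} (X : Subset n) → ∣ X ∣ ≡ 0 → X ≡ ⊥
card≡0⇒⊥ []          _    = refl
card≡0⇒⊥ (false ∷ X) ∣X∣≡0 = cong (false ∷_) (card≡0⇒⊥ X ∣X∣≡0)

card≡1⇒singleton : ∀ {n} (X : Subset n) → ∣ X ∣ ≡ 1 → ∃ λ x → X ≡ ⁅ x ⁆
card≡1⇒singleton (true  ∷ X) ∣X∣≡1 = zero , cong (true ∷_) (card≡0⇒⊥ X (suc-injective ∣X∣≡1))
card≡1⇒singleton (false ∷ X) ∣X∣≡1 with card≡1⇒singleton X ∣X∣≡1
... | x , X≡⁅x⁆ = suc x , cong (false ∷_) X≡⁅x⁆

toList-∷⁺ : ∀ {A : Set} (a : A) xs → toList (a ∷⁺ xs) ≡ a ∷ toList xs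
toList-∷⁺ a (_ ∷ _) = refl

toList-++⁺ : ∀ {A : Set} (xs : List A) ys → toList (xs ++⁺ ys) ≡ xs ++ toList ys
toList-++⁺ []       ys = refl
toList-++⁺ (x ∷ xs) ys = trans (toList-∷⁺ x (xs ++⁺ ys)) (cong (x ∷_) (toList-++⁺ xs ys))

module Weights {n k : ℕ} (δ : Automaton n k) (u : Fin n → ℕ) where

  mass : (Fin n → Bool) → ℕ
  mass P = ∑[ q < n ] (χ (P q) * u q)

  weight≡mass : ∀ D → weight δ u D ≡ mass (lookup D)
  weight≡mass D = trans (sum-allFin (λ q → if lookup D q then u q else 0))
                        (sum-cong-≗ λ q → if-as-χ (lookup D q) (u q))
    where
    if-as-χ : ∀ b x → (if b then x else 0) ≡ χ b * x
    if-as-χ true  x = sym (*-identityˡ x)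
    if-as-χ false x = refl

  weight-⊤ : weight δ u ⊤ ≡ mass (λ _ → true)
  weight-⊤ = trans (weight≡mass ⊤) (sum-cong-≗ λ q → cong (λ b → χ b * u q) (lookup-replicate q true))

  mass-mono : ∀ {P Q} → (∀ r → T (P r) → T (Q r)) → mass P ≤ mass Q
  mass-mono P⊆Q = ∑-mono λ r → *-monoˡ-≤ (u r) (χ-mono (P⊆Q r))

  mass-null : ∀ {P} → (∀ r → ¬ T (P r)) → mass P ≡ 0
  mass-null {P} P-empty =
    trans (sum-cong-≗ λ r → cong (_* u r) (χ-false (P-empty r))) (trans (∑-const n 0) (*-zeroʳ n))
    where
    χ-false : ∀ {b} → ¬ T b → χ b ≡ 0
    χ-false {false} _  = refl
    χ-false {true}  ¬T = ⊥-elim (¬T tt)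

  fibres-partition : ∀ {m} (f : Fin n → Fin m) →
                     mass (λ _ → true) ≡ ∑[ c < m ] mass (λ q → does (f q ≟ c))
  fibres-partition {m} f = sym (begin
    ∑[ c < m ] ∑[ q < n ] (χ (does (f q ≟ c)) * u q)
      ≡⟨ ∑-comm (λ c q → χ (does (f q ≟ c)) * u q) ⟩
    ∑[ q < n ] ∑[ c < m ] (χ (does (f q ≟ c)) * u q)
      ≡⟨ sum-cong-≗ (λ q → ∑-select (f q) (λ _ → u q)) ⟩
    ∑[ q < n ] u q
      ≡⟨ sum-cong-≗ (λ q → *-identityˡ (u q)) ⟨
    mass (λ _ → true)
      ∎)
    where open ≡-Reasoning

  adj-as-sum : ∀ q j → adj δ q j ≡ ∑[ a < k ] χ (does (δ q a ≟ j))
  adj-as-sum q j = length-filter-tabulate (λ a → δ q a ≟ j) id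

  letters-to-edges : ∀ (P : Fin n → Bool) q →
                     ∑[ a < k ] χ (P (δ q a)) ≡ ∑[ j < n ] (χ (P j) * adj δ q j)
  letters-to-edges P q = begin
    ∑[ a < k ] χ (P (δ q a))
      ≡⟨ sum-cong-≗ (λ a → ∑-select (δ q a) (χ ∘ P)) ⟨
    ∑[ a < k ] ∑[ j < n ] (χ (does (δ q a ≟ j)) * χ (P j))
      ≡⟨ ∑-comm (λ a j → χ (does (δ q a ≟ j)) * χ (P j)) ⟩
    ∑[ j < n ] ∑[ a < k ] (χ (does (δ q a ≟ j)) * χ (P j))
      ≡⟨ sum-cong-≗ (λ j → *-distribʳ-sum (χ (P j)) (λ a → χ (does (δ q a ≟ j)))) ⟨
    ∑[ j < n ] (∑[ a < k ] χ (does (δ q a ≟ j)) * χ (P j))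
      ≡⟨ sum-cong-≗ (λ j → cong (_* χ (P j)) (adj-as-sum q j)) ⟨
    ∑[ j < n ] (adj δ q j * χ (P j))
      ≡⟨ sum-cong-≗ (λ j → *-comm (adj δ q j) (χ (P j))) ⟩
    ∑[ j < n ] (χ (P j) * adj δ q j)
      ∎
    where open ≡-Reasoning

  module Eigenvector (ev : ℕ)
                     (eig : ∀ j → List.sum (map (λ i → u i * adj δ i j) (allFin n)) ≡ ev * u j) where

    eigen : ∀ j → ∑[ q < n ] (u q * adj δ q j) ≡ ev * u j
    eigen j = trans (sym (sum-allFin (λ q → u q * adj δ q j))) (eig j)

    stationary : ∀ (P : Fin n → Bool) → ∑[ a < k ] mass (λ q → P (δ q a)) ≡ ev * mass P
    stationary P = begin
      ∑[ a < k ] ∑[ q < n ] (χ (P (δ q a)) * u q)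
        ≡⟨ ∑-comm (λ a q → χ (P (δ q a)) * u q) ⟩
      ∑[ q < n ] ∑[ a < k ] (χ (P (δ q a)) * u q)
        ≡⟨ sum-cong-≗ (λ q → *-distribʳ-sum (u q) (λ a → χ (P (δ q a)))) ⟨
      ∑[ q < n ] (∑[ a < k ] χ (P (δ q a)) * u q)
        ≡⟨ sum-cong-≗ (λ q → cong (_* u q) (letters-to-edges P q)) ⟩
      ∑[ q < n ] (∑[ j < n ] (χ (P j) * adj δ q j) * u q)
        ≡⟨ sum-cong-≗ (λ q → *-distribʳ-sum (u q) (λ j → χ (P j) * adj δ q j)) ⟩
      ∑[ q < n ] ∑[ j < n ] (χ (P j) * adj δ q j * u q)
        ≡⟨ ∑-comm (λ q j → χ (P j) * adj δ q j * u q) ⟩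
      ∑[ j < n ] ∑[ q < n ] (χ (P j) * adj δ q j * u q)
        ≡⟨ sum-cong-≗ (λ j → sum-cong-≗ λ q → xy∙z≈x∙zy (χ (P j)) (adj δ q j) (u q)) ⟩
      ∑[ j < n ] ∑[ q < n ] (χ (P j) * (u q * adj δ q j))
        ≡⟨ sum-cong-≗ (λ j → *-distribˡ-sum (χ (P j)) (λ q → u q * adj δ q j)) ⟨
      ∑[ j < n ] (χ (P j) * ∑[ q < n ] (u q * adj δ q j))
        ≡⟨ sum-cong-≗ (λ j → cong (χ (P j) *_) (eigen j)) ⟩
      ∑[ j < n ] (χ (P j) * (ev * u j))
        ≡⟨ sum-cong-≗ (λ j → x∙yz≈y∙xz (χ (P j)) ev (u j)) ⟩
      ∑[ j < n ] (ev * (χ (P j) * u j))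
        ≡⟨ *-distribˡ-sum ev (λ j → χ (P j) * u j) ⟨
      ev * mass P
        ∎
      where open ≡-Reasoning

    -- For a positive eigenvector, stationarity of P = Γ forces ev = k.
    eigenvalue≡outdegree : (∀ i → 0 < u i) → Fin n → ev ≡ k
    eigenvalue≡outdegree positive q = *-cancelʳ-≡ ev k total {{>-nonZero total>0}}
      (trans (sym (stationary (λ _ → true))) (∑-const k total))
      where
      total : ℕ
      total = mass (λ _ → true)
      total>0 : 0 < total
      total>0 = ≤-trans (positive q) (≤-trans (m≤m+n (u q) 0) (∑-term (λ r → χ true * u r) q))

module Images {n k : ℕ} (δ : Automaton n k) where

  run⁺-++⁺ : ∀ q x t → run⁺ δ q (x ++⁺ t) ≡ run⁺ δ (run δ q x) t
  run⁺-++⁺ q x t = trans (cong (run δ q) (toList-++⁺ x t)) (foldl-++ δ q x (toList t))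

  img-intro : ∀ {D p} s → p ∈ D → run⁺ δ p s ∈ img δ D s
  img-intro {D} {p} s p∈D =
    ∈-tabulate⁺ (any⁺ _ (lose (∈-allFin p) (Equivalence.from T-∧ (∈⇒T p∈D , fromWitness refl))))

  img-elim : ∀ {D q} s → q ∈ img δ D s → ∃ λ p → p ∈ D × run⁺ δ p s ≡ q
  img-elim {D} {q} s q∈ with satisfied (any⁻ _ (allFin n) (∈-tabulate⁻ q∈))
  ... | p , Tp with Equivalence.to T-∧ Tp
  ...   | p∈D , p↦q = p , T⇒∈ D p p∈D , toWitness p↦q

  img-singleton : ∀ {X r₀} s e → r₀ ∈ X → (∀ r → r ∈ X → run⁺ δ r s ≡ e) → img δ X s ≡ ⁅ e ⁆
  img-singleton {X} {r₀} s e r₀∈X X↦e = ⊆-antisym img⊆ ⊆img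
    where
    img⊆ : img δ X s ⊆ ⁅ e ⁆
    img⊆ q∈ with img-elim s q∈
    ... | r , r∈X , r↦q = subst (_∈ ⁅ e ⁆) (trans (sym (X↦e r r∈X)) r↦q) (x∈⁅x⁆ e)
    ⊆img : ⁅ e ⁆ ⊆ img δ X s
    ⊆img q∈ = subst (_∈ img δ X s) (trans (X↦e r₀ r₀∈X) (sym (x∈⁅y⁆⇒x≡y e q∈))) (img-intro s r₀∈X)

  collapse-target : ∀ D t → ∣ img δ D t ∣ ≡ 1 →
                    ∃ λ p → (∀ r → r ∈ D → run⁺ δ r t ≡ p) × ∃ λ r₀ → r₀ ∈ D
  collapse-target D t ∣Dt∣≡1 with card≡1⇒singleton (img δ D t) ∣Dt∣≡1
  ... | p , Dt≡⁅p⁆ = p , D↦p , r₀∈D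
    where
    D↦p : ∀ r → r ∈ D → run⁺ δ r t ≡ p
    D↦p r r∈D = x∈⁅y⁆⇒x≡y p (subst (run⁺ δ r t ∈_) Dt≡⁅p⁆ (img-intro t r∈D))
    r₀∈D : ∃ λ r₀ → r₀ ∈ D
    r₀∈D with img-elim t (subst (p ∈_) (sym Dt≡⁅p⁆) (x∈⁅x⁆ p))
    ... | r₀ , r₀∈D , _ = r₀ , r₀∈D

module Maximal {n k : ℕ} (δ : Automaton n k) (u : Fin n → ℕ) (D : Subset n)
               (maximal : ∀ D′ → Collapsible δ D′ → weight δ u D′ ≤ weight δ u D) where
  open Images δ
  open Weights δ u

  collapsible-bound : (S : Fin n → Bool) (z : List⁺ (Fin k)) (e : Fin n) →
                      (∀ r → T (S r) → run⁺ δ r z ≡ e) → mass S ≤ weight δ u D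
  collapsible-bound S z e S↦e with any? (λ r → T? (S r))
  ... | no S-empty = subst (_≤ weight δ u D) (sym (mass-null λ r Sr → S-empty (r , Sr))) z≤n
  ... | yes (r₀ , Sr₀) = begin
    mass S          ≡⟨ sum-cong-≗ (λ r → cong (λ b → χ b * u r) (lookup∘tabulate S r)) ⟨
    mass (lookup X) ≡⟨ weight≡mass X ⟨
    weight δ u X    ≤⟨ maximal X (z , trans (cong ∣_∣ X↦e) (∣⁅x⁆∣≡1 e)) ⟩
    weight δ u D    ∎
    where
    open ≤-Reasoning
    X : Subset n
    X = tabulate S
    X↦e : img δ X z ≡ ⁅ e ⁆
    X↦e = img-singleton z e (∈-tabulate⁺ Sr₀) (λ r r∈X → S↦e r (∈-tabulate⁻ r∈X))

  module Rigidity (stationary : ∀ P → ∑[ a < k ] mass (λ q → P (δ q a)) ≡ k * mass P)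
                  (t : List⁺ (Fin k)) (p : Fin n) (D↦p : ∀ r → r ∈ D → run⁺ δ r t ≡ p) where

    F : Fin n → Bool
    F q = does (run⁺ δ q t ≟ p)

    preimage : List (Fin k) → Fin n → Bool
    preimage x q = F (run δ q x)

    -- x t collapses F x⁻¹ onto p.
    preimage-bound : ∀ x → mass (preimage x) ≤ weight δ u D
    preimage-bound x =
      collapsible-bound (preimage x) (x ++⁺ t) p λ r Fxr → trans (run⁺-++⁺ r x t) (T⇒≡ Fxr)

    D⊆F : weight δ u D ≤ mass F
    D⊆F = subst (_≤ mass F) (sym (weight≡mass D))
                (mass-mono λ r r∈D → ≡⇒T (D↦p r (T⇒∈ D r r∈D)))

    -- F (a x)⁻¹ = (F x⁻¹) a⁻¹, so the k sets F (a x)⁻¹ weigh k · w(D) in total.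
    rigidity : ∀ x → mass (preimage x) ≡ weight δ u D
    rigidity []      = ≤-antisym (preimage-bound []) D⊆F
    rigidity (a ∷ x) = ∑-all-equal (λ b → mass (preimage (b ∷ x))) (weight δ u D)
                         (λ b → preimage-bound (b ∷ x))
                         (trans (stationary (preimage x)) (cong (k *_) (rigidity x))) a

    module Clique (strong : StronglyConnected δ) (r₀ : Fin n) (r₀∈D : r₀ ∈ D)
                  (C : Subset n) (s : List⁺ (Fin k)) (C≡Γs : C ≡ imgΓ δ s)
                  (deadlock : ∀ q q′ → q ∈ C → q′ ∈ C → q ≢ q′ → Deadlock δ q q′) where

      fibre : Fin n → Fin n → Bool
      fibre c q = does (run⁺ δ q s ≟ c)

      lands-in-C : ∀ q → run⁺ δ q s ∈ C
      lands-in-C q = subst (run⁺ δ q s ∈_) (sym C≡Γs) (img-intro s ∈⊤)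

      -- With y leading c into D, c y t = p; any other c′ ∈ C with c′ y t = p
      -- would synchronize with c, so the fibre over c is F (s y)⁻¹.
      clique-fibre : ∀ c → c ∈ C → mass (fibre c) ≡ weight δ u D
      clique-fibre c c∈C with strong c r₀
      ... | y , c↦r₀ =
        trans (sum-cong-≗ λ q → cong (λ b → χ b * u q) (sym (same q))) (rigidity (toList s ++ y))
        where
        c↦p : run⁺ δ (run δ c y) t ≡ p
        c↦p = trans (cong (λ r → run⁺ δ r t) c↦r₀) (D↦p r₀ r₀∈D)
        only-c : ∀ c′ → c′ ∈ C → F (run δ c′ y) ≡ does (c′ ≟ c)
        only-c c′ c′∈C with c′ ≟ c
        ... | yes refl = dec-true (run⁺ δ (run δ c y) t ≟ p) c↦p
        ... | no c′≢c  = dec-false (run⁺ δ (run δ c′ y) t ≟ p) λ c′↦p →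
              proj₂ (deadlock c′ c c′∈C c∈C c′≢c)
                    (y ++⁺ t , trans (run⁺-++⁺ c′ y t) (trans c′↦p (sym (trans (run⁺-++⁺ c y t) c↦p))))
        same : ∀ q → preimage (toList s ++ y) q ≡ fibre c q
        same q = trans (cong F (foldl-++ δ q (toList s) y)) (only-c (run⁺ δ q s) (lands-in-C q))

      -- Outside C the fibres are empty, since Γs = C.
      fibre-mass : ∀ c → mass (fibre c) ≡ χ (lookup C c) * weight δ u D
      fibre-mass c with lookup C c in C∋c
      ... | true  = trans (clique-fibre c (T⇒∈ C c (subst T (sym C∋c) tt))) (sym (*-identityˡ _))
      ... | false = mass-null λ q qs≡c →
                      subst T C∋c (∈⇒T (subst (_∈ C) (T⇒≡ qs≡c) (lands-in-C q)))

      clique-count : ∣ C ∣ * weight δ u D ≡ weight δ u ⊤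
      clique-count = sym (begin
        weight δ u ⊤
          ≡⟨ weight-⊤ ⟩
        mass (λ _ → true)
          ≡⟨ fibres-partition (λ q → run⁺ δ q s) ⟩
        ∑[ c < n ] mass (fibre c)
          ≡⟨ sum-cong-≗ fibre-mass ⟩
        ∑[ c < n ] (χ (lookup C c) * weight δ u D)
          ≡⟨ *-distribʳ-sum (weight δ u D) (λ c → χ (lookup C c)) ⟨
        (∑[ c < n ] χ (lookup C c)) * weight δ u D
          ≡⟨ cong (_* weight δ u D) (∣∣-as-sum C) ⟨
        ∣ C ∣ * weight δ u D
          ∎)
        where open ≡-Reasoning

lemma1 : (n k : ℕ) (δ : Automaton n k) (u : Fin n → ℕ)
       → AGW δ → IsWeightVector δ u
       → (D : Subset n) → FMaximal δ u D
       → (C : Subset n) → FClique δ C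
       → ∣ C ∣ * weight δ u D ≡ weight δ u ⊤
lemma1 n k δ u (strong , _) ((ev , eig) , positive , _) D ((t , ∣Dt∣≡1) , maximal)
       C ((s , C≡Γs) , deadlock)
  with Images.collapse-target δ D t ∣Dt∣≡1
... | p , D↦p , r₀ , r₀∈D = clique-count
  where
  open Weights δ u
  open Eigenvector ev eig
  stationary-k : ∀ P → ∑[ a < k ] mass (λ q → P (δ q a)) ≡ k * mass P
  stationary-k P = trans (stationary P) (cong (_* mass P) (eigenvalue≡outdegree positive r₀))
  open Maximal δ u D maximal
  open Rigidity stationary-k t p D↦p
  open Clique strong r₀ r₀∈D C s C≡Γs deadlock
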